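{- For all integers $n, i, j$ with $1 \le i \le j \le n$, the number of Dyck paths of semilength $n$ with exactly $i$ returns to ground level and exactly $j$ peaks equals \[ N_i(n,j) = \frac{i}{n}\binom{n}{j}\binom{n-i-1}{j-i}. \]
   Context: A Dyck path of semilength $n$ is a lattice path from $(0,0)$ to $(2n,0)$ consisting of $n$ upsteps $U=(1,1)$ and $n$ downsteps $D=(1,-1)$ that never goes below the $x$-axis. A return to ground level is a downstep ending on the $x$-axis (i.e., at a point $(m,0)$ with $m>0$). A peak is an occurrence of an upstep immediately followed by a downstep ($UD$). -}

module Defs where

open import Data.Nat using (ℕ; zero; suc; _+_; _≡ᵇ_)
open import Data.Bool using (Bool; true; false; if_then_else_)
open import Data.List using (List; []; _∷_; length; filter; map; _++_)

-- A step: true = U = (1,1), false = D = (1,-1).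
Step : Set
Step = Bool

pattern U = true
pattern D = false

returnsFrom : ℕ → List Step → ℕ
returnsFrom h [] = 0
returnsFrom h (U ∷ w) = returnsFrom (suc h) w
returnsFrom zero (D ∷ w) = returnsFrom zero w   -- not reached for Dyck paths
returnsFrom (suc zero) (D ∷ w) = suc (returnsFrom zero w)
returnsFrom (suc (suc h)) (D ∷ w) = returnsFrom (suc h) w

returns : List Step → ℕ
returns = returnsFrom 0

peaks : List Step → ℕ
peaks [] = 0
peaks (U ∷ D ∷ w) = suc (peaks (D ∷ w))
peaks (_ ∷ w) = peaks w

words : ℕ → List (List Step)
words zero = [] ∷ []
words (suc m) = map (U ∷_) (words m) ++ map (D ∷_) (words m)

-- Dyck check: starting at height h, the walk never goes below the x-axis
-- and ends at height 0. A word of length 2n passing this check has n U's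
-- and n D's, i.e. it is a Dyck path of semilength n.
dyckFromᵇ : ℕ → List Step → Bool
dyckFromᵇ zero [] = true
dyckFromᵇ (suc _) [] = false
dyckFromᵇ h (U ∷ w) = dyckFromᵇ (suc h) w
dyckFromᵇ zero (D ∷ w) = false
dyckFromᵇ (suc h) (D ∷ w) = dyckFromᵇ h w

countᵇ : (List Step → Bool) → List (List Step) → ℕ
countᵇ p [] = 0
countᵇ p (w ∷ ws) = if p w then suc (countᵇ p ws) else countᵇ p ws

_∧ᵇ_ : Bool → Bool → Bool
true ∧ᵇ b = b
false ∧ᵇ _ = false

numDyck : ℕ → ℕ → ℕ → ℕ
numDyck n i j =
  countᵇ (λ w → dyckFromᵇ 0 w ∧ᵇ ((returns w ≡ᵇ i) ∧ᵇ (peaks w ≡ᵇ j)))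
         (words (n + n))

module Submission where

-- Count more generally the walks that start at height h, end on the ground without going below
-- it and have m + 1 up-steps, r returns and p peaks, split by their first step. Removing that
-- step gives a recurrence in (h, m), with the all-down walk as base case. Scaled by
-- (m + 1) / C(m + 1, p), the number of those that start with U is
-- r C(h+m-r, p-r) + h C(h+m-r, p-r-1), for the binomial coefficient extended to integer
-- arguments, and so is that of the walks from height h + 1 with r + 1 returns that start with D:
-- the recurrence becomes Pascal's rule when the first step is D and absorption when it is U.
-- A Dyck path with i returns is what follows a down-step from height 1, so h = 0 is the theorem.

open import Data.Bool using (Bool; true; false; if_then_else_)
open import Data.List using (List; []; _∷_; map; _++_)
open import Data.Nat as ℕ using (ℕ; zero; suc; s≤s) hiding (module ℕ)
import Data.Nat.Properties as ℕₚ
import Data.Nat.Tactic.RingSolver as ℕ-Solver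
open import Data.Nat.Combinatorics using (_C_; nCk+nC[k+1]≡[n+1]C[k+1]; nC1≡n; nCn≡1)
open import Data.Integer as ℤ using (ℤ; +_; -[1+_]) renaming (suc to sucℤ) hiding (module ℤ)
import Data.Integer.Properties as ℤₚ
open import Data.Integer.Tactic.RingSolver using (solve-∀; solve)
open import Relation.Binary.PropositionalEquality
open import Relation.Nullary using (Dec; yes; no)
open import Defs

module WalkCounts where

  open ℕ using (_+_; _<_; _≡ᵇ_)

  countᵇ-++ : ∀ p (xs ys : List (List Step)) → countᵇ p (xs ++ ys) ≡ countᵇ p xs + countᵇ p ys
  countᵇ-++ p [] ys = refl
  countᵇ-++ p (x ∷ xs) ys with p x
  ... | true  = cong suc (countᵇ-++ p xs ys)
  ... | false = countᵇ-++ p xs ys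

  countᵇ-map : ∀ p f (xs : List (List Step)) → countᵇ p (map f xs) ≡ countᵇ (λ w → p (f w)) xs
  countᵇ-map p f [] = refl
  countᵇ-map p f (x ∷ xs) with p (f x)
  ... | true  = cong suc (countᵇ-map p f xs)
  ... | false = countᵇ-map p f xs

  countᵇ-cong : ∀ {p q} → (∀ w → p w ≡ q w) → ∀ xs → countᵇ p xs ≡ countᵇ q xs
  countᵇ-cong p≗q [] = refl
  countᵇ-cong {p} {q} p≗q (x ∷ xs) rewrite p≗q x =
    cong (λ n → if q x then suc n else n) (countᵇ-cong p≗q xs)

  countᵇ-false : ∀ {p} → (∀ w → p w ≡ false) → ∀ xs → countᵇ p xs ≡ 0
  countᵇ-false p≗false [] = refl
  countᵇ-false p≗false (x ∷ xs) rewrite p≗false x = countᵇ-false p≗false xs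

  countᵇ-words-suc : ∀ p L → countᵇ p (words (suc L)) ≡
    countᵇ (λ w → p (U ∷ w)) (words L) + countᵇ (λ w → p (D ∷ w)) (words L)
  countᵇ-words-suc p L = trans (countᵇ-++ p (map (U ∷_) (words L)) (map (D ∷_) (words L)))
    (cong₂ _+_ (countᵇ-map p (U ∷_) (words L)) (countᵇ-map p (D ∷_) (words L)))

  ∧ᵇ-falseʳ : ∀ b → b ∧ᵇ false ≡ false
  ∧ᵇ-falseʳ true  = refl
  ∧ᵇ-falseʳ false = refl

  -- With afterUp = true the walk is read as continuing a path whose last
  -- step was U, so an initial D completes a peak.
  peaksAfter : Bool → List Step → ℕ
  peaksAfter false w = peaks w
  peaksAfter true  w = peaks (U ∷ w)

  isWalkᵇ : Bool → ℕ → ℕ → ℕ → List Step → Bool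
  isWalkᵇ afterUp h r p w =
    dyckFromᵇ h w ∧ᵇ ((returnsFrom h w ≡ᵇ r) ∧ᵇ (peaksAfter afterUp w ≡ᵇ p))

  walks          : Bool → ℕ → ℕ → ℕ → ℕ → ℕ
  walksDownFirst : Bool → ℕ → ℕ → ℕ → ℕ → ℕ
  walksAfterDown : ℕ → ℕ → ℕ → ℕ → ℕ

  walks afterUp h (suc L) r p = walks true (suc h) L r p + walksDownFirst afterUp h L r p
  walks afterUp zero    zero zero    zero    = 1
  walks afterUp zero    zero zero    (suc p) = 0
  walks afterUp zero    zero (suc r) p       = 0
  walks afterUp (suc h) zero r       p       = 0

  walksDownFirst afterUp zero    L r p       = 0
  walksDownFirst false   (suc h) L r p       = walksAfterDown h L r p
  walksDownFirst true    (suc h) L r zero    = 0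
  walksDownFirst true    (suc h) L r (suc p) = walksAfterDown h L r p

  -- The remaining walk after a down-step to height h; the step itself is a return when h = 0.
  walksAfterDown zero    L zero    p = 0
  walksAfterDown zero    L (suc r) p = walks false zero L r p
  walksAfterDown (suc h) L r       p = walks false (suc h) L r p

  isWalkᵇ-U : ∀ afterUp h r p w → isWalkᵇ afterUp h r p (U ∷ w) ≡ isWalkᵇ true (suc h) r p w
  isWalkᵇ-U false zero    r p w = refl
  isWalkᵇ-U false (suc h) r p w = refl
  isWalkᵇ-U true  zero    r p w = refl
  isWalkᵇ-U true  (suc h) r p w = refl

  countᵇ-isWalkᵇ : ∀ afterUp h L r p → countᵇ (isWalkᵇ afterUp h r p) (words L) ≡ walks afterUp h L r p
  countᵇ-isWalkᵇ afterUp h (suc L) r p =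
    trans (countᵇ-words-suc (isWalkᵇ afterUp h r p) L)
      (cong₂ _+_
        (trans (countᵇ-cong (isWalkᵇ-U afterUp h r p) (words L)) (countᵇ-isWalkᵇ true (suc h) L r p))
        (downFirst afterUp h r p))
    where
    downFirst : ∀ afterUp h r p →
      countᵇ (λ w → isWalkᵇ afterUp h r p (D ∷ w)) (words L) ≡ walksDownFirst afterUp h L r p
    downFirst afterUp zero r p = countᵇ-false (λ _ → refl) (words L)
    downFirst false (suc zero) zero p = countᵇ-false (λ w → ∧ᵇ-falseʳ (dyckFromᵇ 0 w)) (words L)
    downFirst false (suc zero) (suc r) p = countᵇ-isWalkᵇ false zero L r p
    downFirst false (suc (suc h)) r p = countᵇ-isWalkᵇ false (suc h) L r p
    downFirst true (suc h) r zero =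
      countᵇ-false (λ w → trans (cong (dyckFromᵇ h w ∧ᵇ_) (∧ᵇ-falseʳ _)) (∧ᵇ-falseʳ _)) (words L)
    downFirst true (suc zero) zero (suc p) = countᵇ-false (λ w → ∧ᵇ-falseʳ (dyckFromᵇ 0 w)) (words L)
    downFirst true (suc zero) (suc r) (suc p) = countᵇ-isWalkᵇ false zero L r p
    downFirst true (suc (suc h)) r (suc p) = countᵇ-isWalkᵇ false (suc h) L r p
  countᵇ-isWalkᵇ afterUp (suc h) zero r       p       = refl
  countᵇ-isWalkᵇ afterUp zero    zero (suc r) p       = refl
  countᵇ-isWalkᵇ false   zero    zero zero    zero    = refl
  countᵇ-isWalkᵇ false   zero    zero zero    (suc p) = refl
  countᵇ-isWalkᵇ true    zero    zero zero    zero    = refl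
  countᵇ-isWalkᵇ true    zero    zero zero    (suc p) = refl

  walksDownFirst-vanishes : ∀ {h L r} → (∀ p → walksAfterDown h L r p ≡ 0) →
    ∀ afterUp p → walksDownFirst afterUp (suc h) L r p ≡ 0
  walksDownFirst-vanishes vanish false p       = vanish p
  walksDownFirst-vanishes vanish true  zero    = refl
  walksDownFirst-vanishes vanish true  (suc p) = vanish p

  walks-noReturn          : ∀ afterUp h L p → walks afterUp (suc h) L 0 p ≡ 0
  walksAfterDown-noReturn : ∀ h L p → walksAfterDown h L 0 p ≡ 0

  walks-noReturn afterUp h zero    p = refl
  walks-noReturn afterUp h (suc L) p = cong₂ _+_ (walks-noReturn true (suc h) L p)
    (walksDownFirst-vanishes (walksAfterDown-noReturn h L) afterUp p)

  walksAfterDown-noReturn zero    L p = refl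
  walksAfterDown-noReturn (suc h) L p = walks-noReturn false h L p

  walks-short          : ∀ afterUp {h L} r p → L < h → walks afterUp h L r p ≡ 0
  walksAfterDown-short : ∀ {h L} r p → L < h → walksAfterDown h L r p ≡ 0

  walks-short afterUp {suc h} {zero}  r p _          = refl
  walks-short afterUp {suc h} {suc L} r p (s≤s L<h) = cong₂ _+_
    (walks-short true r p (ℕₚ.m<n⇒m<1+n (ℕₚ.m<n⇒m<1+n L<h)))
    (walksDownFirst-vanishes (λ p → walksAfterDown-short r p L<h) afterUp p)

  walksAfterDown-short {suc h} r p L<h = walks-short false r p L<h

  walks-noPeak : ∀ h L r → walks true (suc h) L r 0 ≡ 0
  walks-noPeak h zero    r = refl
  walks-noPeak h (suc L) r = cong (_+ 0) (walks-noPeak (suc h) L r)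

  -- The only candidate of length h from height h is D^h.
  walksAfterDown-allDown : ∀ h r p → walksAfterDown h h r p ≡ walksAfterDown 0 0 r p
  walksAfterDown-allDown zero    r p = refl
  walksAfterDown-allDown (suc h) r p =
    trans (cong (_+ walksAfterDown h h r p) (walks-short true r p (ℕₚ.m<n⇒m<1+n (ℕₚ.n<1+n h))))
          (walksAfterDown-allDown h r p)

  lengthFrom : ℕ → ℕ → ℕ
  lengthFrom h m = h + (m + m)

  lengthFrom-suc : ∀ h m → lengthFrom h (suc m) ≡ suc (suc (lengthFrom h m))
  lengthFrom-suc h m = trans (ℕₚ.+-suc h (m + suc m))
    (cong suc (trans (cong (λ x → h + x) (ℕₚ.+-suc m m)) (ℕₚ.+-suc h (m + m))))

  -- Both count walks with m + 1 up-steps, leaving out their first step: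
  -- afterUp h m those from height h that start with U,
  -- afterDown h m those from height h + 1 that start with D.
  afterUp afterDown : ℕ → ℕ → ℕ → ℕ → ℕ
  afterUp   h m = walks true (suc h) (suc (lengthFrom h m))
  afterDown h m = walksAfterDown h (suc (suc (lengthFrom h m)))

  afterUp-zero : ∀ h r p → afterUp h 0 r (suc p) ≡ walksAfterDown 0 0 r p
  afterUp-zero h r p = begin
      afterUp h 0 r (suc p)
    ≡⟨ cong (λ L → walks true (suc h) (suc L) r (suc p)) (ℕₚ.+-identityʳ h) ⟩
      walks true (suc (suc h)) h r (suc p) + walksAfterDown h h r p
    ≡⟨ cong₂ _+_ (walks-short true r (suc p) (ℕₚ.m<n⇒m<1+n (ℕₚ.n<1+n h))) (walksAfterDown-allDown h r p) ⟩
      walksAfterDown 0 0 r p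
    ∎
    where open ≡-Reasoning

  afterUp-suc : ∀ h m r p → afterUp h (suc m) r (suc p) ≡ afterUp (suc h) m r (suc p) + afterDown h m r p
  afterUp-suc h m r p = cong (λ L → walks true (suc h) (suc L) r (suc p)) (lengthFrom-suc h m)

  afterDown-zero : ∀ m r p → afterDown 0 m (suc r) p ≡ afterUp 0 m r p
  afterDown-zero m r p = ℕₚ.+-identityʳ (afterUp 0 m r p)

  afterDown-suc : ∀ h m r p → afterDown (suc h) m r p ≡ afterUp (suc h) m r p + afterDown h m r p
  afterDown-suc h m r p = refl

module NaturalBinomial where

  open ℕ using (_+_; _*_)
  open ≡-Reasoning

  [k+1]*[n+1]C[k+1]≡[n+1]*nCk : ∀ n k → suc k * (suc n C suc k) ≡ suc n * (n C k)
  [k+1]*[n+1]C[k+1]≡[n+1]*nCk n zero =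
    trans (ℕₚ.+-identityʳ (suc n C 1)) (trans (nC1≡n (suc n)) (sym (ℕₚ.*-identityʳ (suc n))))
  [k+1]*[n+1]C[k+1]≡[n+1]*nCk zero (suc k) = ℕₚ.*-zeroʳ (suc (suc k))
  [k+1]*[n+1]C[k+1]≡[n+1]*nCk (suc n) (suc k) = begin
      suc (suc k) * (suc (suc n) C suc (suc k))
    ≡⟨ cong (suc (suc k) *_) (sym (nCk+nC[k+1]≡[n+1]C[k+1] (suc n) (suc k))) ⟩
      suc (suc k) * (a + b)
    ≡⟨ split k a b ⟩
      suc k * a + a + suc (suc k) * b
    ≡⟨ cong₂ (λ x y → x + a + y)
             ([k+1]*[n+1]C[k+1]≡[n+1]*nCk n k) ([k+1]*[n+1]C[k+1]≡[n+1]*nCk n (suc k)) ⟩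
      suc n * (n C k) + a + suc n * (n C suc k)
    ≡⟨ merge n (n C k) a (n C suc k) ⟩
      suc n * (n C k + n C suc k) + a
    ≡⟨ cong (λ x → suc n * x + a) (nCk+nC[k+1]≡[n+1]C[k+1] n k) ⟩
      suc n * a + a
    ≡⟨ ℕₚ.+-comm (suc n * a) a ⟩
      suc (suc n) * a
    ∎
    where
    a b : ℕ
    a = suc n C suc k
    b = suc n C suc (suc k)
    split : ∀ k a b → suc (suc k) * (a + b) ≡ suc k * a + a + suc (suc k) * b
    split = ℕ-Solver.solve-∀
    merge : ∀ n x a y → suc n * x + a + suc n * y ≡ suc n * (x + y) + a
    merge = ℕ-Solver.solve-∀

module GeneralisedBinomial where

  open ℤ using (_+_; _-_; _*_; -_; _^_; pred; -1ℤ; 0ℤ; 1ℤ)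
  open NaturalBinomial
  open ≡-Reasoning

  pascal-ℤ : ∀ n k → + (suc n C suc k) ≡ + (n C k) + + (n C suc k)
  pascal-ℤ n k = cong +_ (sym (nCk+nC[k+1]≡[n+1]C[k+1] n k))

  [k+1]*[n+1]C[k+1]≡[n+1]*nCk-ℤ : ∀ n k → + suc k * + (suc n C suc k) ≡ + suc n * + (n C k)
  [k+1]*[n+1]C[k+1]≡[n+1]*nCk-ℤ n k = begin
    + suc k * + (suc n C suc k)   ≡⟨ ℤₚ.pos-* (suc k) _ ⟨
    + (suc k ℕ.* (suc n C suc k)) ≡⟨ cong +_ ([k+1]*[n+1]C[k+1]≡[n+1]*nCk n k) ⟩
    + (suc n ℕ.* (n C k))         ≡⟨ ℤₚ.pos-* (suc n) _ ⟩
    + suc n * + (n C k)           ∎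

  private
    pascal-absorb₁ : ∀ n k {a b c} → c ≡ a + b → (1ℤ + k) * c ≡ (1ℤ + n) * a →
                     (1ℤ + k) * b ≡ ((1ℤ + n) - (1ℤ + k)) * a
    pascal-absorb₁ n k {a} {b} refl absorb = begin
      (1ℤ + k) * b                          ≡⟨ solve (k ∷ a ∷ b ∷ []) ⟩
      (1ℤ + k) * (a + b) - (1ℤ + k) * a     ≡⟨ cong (_- (1ℤ + k) * a) absorb ⟩
      (1ℤ + n) * a - (1ℤ + k) * a           ≡⟨ solve (n ∷ k ∷ a ∷ []) ⟩
      ((1ℤ + n) - (1ℤ + k)) * a             ∎

    pascal-absorb₂ : ∀ n k {a b c} → c ≡ a + b → (1ℤ + k) * c ≡ (1ℤ + n) * a →
                     (1ℤ + n) * b ≡ (n - k) * c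
    pascal-absorb₂ n k {a} {b} refl absorb = begin
      (1ℤ + n) * b                          ≡⟨ solve (n ∷ a ∷ b ∷ []) ⟩
      (1ℤ + n) * (a + b) - (1ℤ + n) * a     ≡⟨ cong (λ t → (1ℤ + n) * (a + b) - t) absorb ⟨
      (1ℤ + n) * (a + b) - (1ℤ + k) * (a + b) ≡⟨ solve (n ∷ k ∷ a ∷ b ∷ []) ⟩
      (n - k) * (a + b)                     ∎

  [n+1]*nC[k+1]≡[n-k]*[n+1]C[k+1] : ∀ n k → + suc n * + (n C suc k) ≡ (+ n - + k) * + (suc n C suc k)
  [n+1]*nC[k+1]≡[n-k]*[n+1]C[k+1] n k =
    pascal-absorb₂ (+ n) (+ k) (pascal-ℤ n k) ([k+1]*[n+1]C[k+1]≡[n+1]*nCk-ℤ n k)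

  -- The polynomial s(s-1)...(s-k+1)/k! at integers s (so (-1)^k C(n+k, k) at s = -(n+1)),
  -- and 0 for k < 0: Pascal's rule and absorption then hold without side conditions.
  binom : ℤ → ℤ → ℤ
  binom s        -[1+ _ ] = 0ℤ
  binom (+ n)    (+ k)    = + (n C k)
  binom -[1+ n ] (+ k)    = -1ℤ ^ k * + ((n ℕ.+ k) C k)

  binom-zero : ∀ s → binom s (+ 0) ≡ 1ℤ
  binom-zero (+ n)    = refl
  binom-zero -[1+ n ] = refl

  binom-pascal : ∀ s k → binom (sucℤ s) k ≡ binom s k + binom s (pred k)
  binom-pascal s           -[1+ k ] = refl
  binom-pascal s           (+ zero) = trans (binom-zero (sucℤ s)) (sym (cong (_+ 0ℤ) (binom-zero s)))
  binom-pascal (+ n)       (+ suc k) = trans (pascal-ℤ n k) (ℤₚ.+-comm (+ (n C k)) (+ (n C suc k)))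
  binom-pascal -[1+ zero ] (+ suc k) = sym (begin
      -1ℤ * x * + (suc k C suc k) + x * + (k C k)
    ≡⟨ cong₂ (λ a b → -1ℤ * x * + a + x * + b) (nCn≡1 (suc k)) (nCn≡1 k) ⟩
      -1ℤ * x * 1ℤ + x * 1ℤ
    ≡⟨ cancel x ⟩
      0ℤ
    ∎)
    where
    x : ℤ
    x = -1ℤ ^ k
    cancel : ∀ x → -1ℤ * x * 1ℤ + x * 1ℤ ≡ 0ℤ
    cancel = solve-∀
  binom-pascal -[1+ suc n ] (+ suc k)
    rewrite ℕₚ.+-suc n k | sym (nCk+nC[k+1]≡[n+1]C[k+1] (suc (n ℕ.+ k)) k) =
      regroup (-1ℤ ^ k) (+ (suc (n ℕ.+ k) C k)) (+ (suc (n ℕ.+ k) C suc k))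
    where
    regroup : ∀ x a b → -1ℤ * x * b ≡ -1ℤ * x * (a + b) + x * a
    regroup = solve-∀

  binom-pascal-suc : ∀ s k → binom (sucℤ s) (sucℤ k) ≡ binom s (sucℤ k) + binom s k
  binom-pascal-suc s k =
    trans (binom-pascal s (sucℤ k)) (cong (λ t → binom s (sucℤ k) + binom s t) (ℤₚ.pred-suc k))

  binom-absorb : ∀ s k → k * binom s k ≡ (sucℤ s - k) * binom s (pred k)
  binom-absorb s           -[1+ k ] =
    trans (ℤₚ.*-zeroʳ -[1+ k ]) (sym (ℤₚ.*-zeroʳ (sucℤ s - -[1+ k ])))
  binom-absorb s           (+ zero) = sym (ℤₚ.*-zeroʳ (sucℤ s - + 0))
  binom-absorb (+ n)       (+ suc k) =
    pascal-absorb₁ (+ n) (+ k) (pascal-ℤ n k) ([k+1]*[n+1]C[k+1]≡[n+1]*nCk-ℤ n k)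
  binom-absorb -[1+ n ]    (+ suc k) rewrite ℕₚ.+-suc n k =
    negate (+ k) (+ n) (-1ℤ ^ k) _ _ ([k+1]*[n+1]C[k+1]≡[n+1]*nCk-ℤ (n ℕ.+ k) k)
    where
    negate : ∀ k n x a c → (1ℤ + k) * c ≡ (1ℤ + (n + k)) * a →
             (1ℤ + k) * (-1ℤ * x * c) ≡ (1ℤ + - (1ℤ + n) - (1ℤ + k)) * (x * a)
    negate k n x a c absorb = begin
      (1ℤ + k) * (-1ℤ * x * c)              ≡⟨ solve (k ∷ x ∷ c ∷ []) ⟩
      -1ℤ * x * ((1ℤ + k) * c)              ≡⟨ cong (-1ℤ * x *_) absorb ⟩
      -1ℤ * x * ((1ℤ + (n + k)) * a)        ≡⟨ solve (k ∷ n ∷ x ∷ a ∷ []) ⟩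
      (1ℤ + - (1ℤ + n) - (1ℤ + k)) * (x * a) ∎

  binom-ℕ : ∀ {a b} k → b ℕ.≤ a → binom (+ a - + b) (+ k) ≡ + ((a ℕ.∸ b) C k)
  binom-ℕ {a} {b} k b≤a rewrite ℤₚ.m-n≡m⊖n a b | ℤₚ.⊖-≥ b≤a = refl

module ClosedForm where

  open ℤ using (_+_; _-_; _*_; pred; 0ℤ; 1ℤ)
  open GeneralisedBinomial
  open ≡-Reasoning

  private
    [1+x]-[1+y]≡x-y : ∀ x y → (1ℤ + x) - (1ℤ + y) ≡ x - y
    [1+x]-[1+y]≡x-y = solve-∀

  shape : ℤ → ℤ → ℤ → ℤ → ℤ
  shape h r s k = r * binom s k + h * binom s (pred k)

  -- At h = 0 and n = m + 1 this is r C(n-r-1, p-r) = n N_r(n,p) / C(n,p).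
  closedForm : ℕ → ℕ → ℕ → ℕ → ℤ
  closedForm h m r p = shape (+ h) (+ r) (+ h + + m - + r) (+ p - + r)

  shape-pascal : ∀ h r s k →
    shape (sucℤ h) (sucℤ r) s k + shape h r s (sucℤ k) ≡ shape (sucℤ h) r (sucℤ s) (sucℤ k)
  shape-pascal h r s k = begin
      (sucℤ r * A + sucℤ h * B) + (r * C + h * binom s (pred (sucℤ k)))
    ≡⟨ cong (λ t → (sucℤ r * A + sucℤ h * B) + (r * C + h * binom s t)) (ℤₚ.pred-suc k) ⟩
      (sucℤ r * A + sucℤ h * B) + (r * C + h * A)
    ≡⟨ regroup h r A B C ⟩
      r * (C + A) + sucℤ h * (A + B)
    ≡⟨ cong₂ (λ x y → r * x + sucℤ h * y) (binom-pascal-suc s k) (binom-pascal s k) ⟨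
      r * binom (sucℤ s) (sucℤ k) + sucℤ h * binom (sucℤ s) k
    ≡⟨ cong (λ t → r * binom (sucℤ s) (sucℤ k) + sucℤ h * binom (sucℤ s) t) (ℤₚ.pred-suc k) ⟨
      shape (sucℤ h) r (sucℤ s) (sucℤ k)
    ∎
    where
    A B C : ℤ
    A = binom s k
    B = binom s (pred k)
    C = binom s (sucℤ k)
    regroup : ∀ h r a b c →
      ((1ℤ + r) * a + (1ℤ + h) * b) + (r * c + h * a) ≡ r * (c + a) + (1ℤ + h) * (a + b)
    regroup = solve-∀

  shape-absorb : ∀ h m r p →
    (sucℤ m - p) * shape (sucℤ h) (sucℤ r) (h + m - r) (p - r) + sucℤ p * shape h r (h + m - r) (p - r)
      ≡ sucℤ m * shape h (sucℤ r) (h + m - r) (p - r)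
  shape-absorb h m r p = begin
      (sucℤ m - p) * (sucℤ r * A + sucℤ h * B) + sucℤ p * (r * A + h * B)
    ≡⟨ regroup h m r p A B ⟩
      sucℤ m * (sucℤ r * A + h * B) + (c * B - k * A)
    ≡⟨ cong (λ t → sucℤ m * (sucℤ r * A + h * B) + (c * B - t)) (binom-absorb s k) ⟩
      sucℤ m * (sucℤ r * A + h * B) + (c * B - c * B)
    ≡⟨ cong (λ t → sucℤ m * (sucℤ r * A + h * B) + t) (ℤₚ.+-inverseʳ (c * B)) ⟩
      sucℤ m * (sucℤ r * A + h * B) + 0ℤ
    ≡⟨ ℤₚ.+-identityʳ _ ⟩
      sucℤ m * shape h (sucℤ r) s k
    ∎
    where
    s k c A B : ℤ
    s = h + m - r
    k = p - r
    c = sucℤ s - k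
    A = binom s k
    B = binom s (pred k)
    regroup : ∀ h m r p a b →
      ((1ℤ + m) - p) * ((1ℤ + r) * a + (1ℤ + h) * b) + (1ℤ + p) * (r * a + h * b)
        ≡ (1ℤ + m) * ((1ℤ + r) * a + h * b) + ((1ℤ + (h + m - r) - (p - r)) * b - (p - r) * a)
    regroup = solve-∀

  closedForm-down : ∀ h m r p →
    closedForm (suc h) m (suc r) p + closedForm h m r p ≡ closedForm (suc h) m r p
  closedForm-down h m r p = begin
      closedForm (suc h) m (suc r) p + closedForm h m r p
    ≡⟨ cong₂ (λ s k → shape (+ suc h) (+ suc r) s κ + shape (+ h) (+ r) σ k)
             ([1+x]-[1+y]≡x-y (+ h + + m) (+ r)) (x-y≡1+[x-[1+y]] (+ p) (+ r)) ⟩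
      shape (+ suc h) (+ suc r) σ κ + shape (+ h) (+ r) σ (sucℤ κ)
    ≡⟨ shape-pascal (+ h) (+ r) σ κ ⟩
      shape (+ suc h) (+ r) (sucℤ σ) (sucℤ κ)
    ≡⟨ cong₂ (shape (+ suc h) (+ r)) ([1+x]-y≡1+[x-y] (+ h + + m) (+ r)) (x-y≡1+[x-[1+y]] (+ p) (+ r)) ⟨
      closedForm (suc h) m r p
    ∎
    where
    σ κ : ℤ
    σ = + h + + m - + r
    κ = + p - + suc r
    x-y≡1+[x-[1+y]] : ∀ x y → x - y ≡ 1ℤ + (x - (1ℤ + y))
    x-y≡1+[x-[1+y]] = solve-∀
    [1+x]-y≡1+[x-y] : ∀ x y → (1ℤ + x) - y ≡ 1ℤ + (x - y)
    [1+x]-y≡1+[x-y] = solve-∀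

  closedForm-up : ∀ h m r p →
    (+ suc m - + p) * closedForm (suc h) m (suc r) (suc p) + + suc p * closedForm h m r p
      ≡ + suc m * closedForm h (suc m) (suc r) (suc p)
  closedForm-up h m r p = begin
      (+ suc m - + p) * closedForm (suc h) m (suc r) (suc p) + + suc p * closedForm h m r p
    ≡⟨ cong₂ (λ s k → (+ suc m - + p) * shape (+ suc h) (+ suc r) s k + + suc p * shape (+ h) (+ r) σ κ)
             ([1+x]-[1+y]≡x-y (+ h + + m) (+ r)) ([1+x]-[1+y]≡x-y (+ p) (+ r)) ⟩
      (+ suc m - + p) * shape (+ suc h) (+ suc r) σ κ + + suc p * shape (+ h) (+ r) σ κ
    ≡⟨ shape-absorb (+ h) (+ m) (+ r) (+ p) ⟩
      + suc m * shape (+ h) (+ suc r) σ κ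
    ≡⟨ cong₂ (λ s k → + suc m * shape (+ h) (+ suc r) s k)
             (x+[1+y]-[1+z]≡x+y-z (+ h) (+ m) (+ r)) ([1+x]-[1+y]≡x-y (+ p) (+ r)) ⟨
      + suc m * closedForm h (suc m) (suc r) (suc p)
    ∎
    where
    σ κ : ℤ
    σ = + h + + m - + r
    κ = + p - + r
    x+[1+y]-[1+z]≡x+y-z : ∀ x y z → x + (1ℤ + y) - (1ℤ + z) ≡ x + y - z
    x+[1+y]-[1+z]≡x+y-z = solve-∀

  closedForm-noPeak : ∀ h m r → closedForm h m (suc r) 0 ≡ 0ℤ
  closedForm-noPeak h m r = cong₂ _+_ (ℤₚ.*-zeroʳ (+ suc r)) (ℤₚ.*-zeroʳ (+ h))

module Enumeration where

  open ℤ using (_+_; _-_; _*_; 0ℤ; 1ℤ)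
  open WalkCounts
  open GeneralisedBinomial
  open ClosedForm
  open ≡-Reasoning

  upStep : ∀ m p a b {X Y Z} →
    + suc m * + a ≡ + (suc m C suc p) * X →
    + suc m * + b ≡ + (suc m C p) * Y →
    (+ suc m - + p) * X + + suc p * Y ≡ + suc m * Z →
    + suc (suc m) * + (a ℕ.+ b) ≡ + (suc (suc m) C suc p) * Z
  upStep m p a b {X} {Y} {Z} countA countB closed = ℤₚ.*-cancelˡ-≡ M₁ _ _ (begin
      M₁ * (M₂ * (+ a + + b))                          ≡⟨ expand M₁ M₂ (+ a) (+ b) ⟩
      M₂ * (M₁ * + a) + M₂ * (M₁ * + b)                ≡⟨ cong₂ (λ x y → M₂ * x + M₂ * y) countA countB ⟩
      M₂ * (c₁ * X) + M₂ * (c₀ * Y)                    ≡⟨ reassociate M₂ c₁ X c₀ Y ⟩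
      (M₂ * c₁) * X + (M₂ * c₀) * Y                    ≡⟨ cong₂ (λ x y → x * X + y * Y) absorbX absorbY ⟩
      ((+ suc m - + p) * C₂) * X + (+ suc p * C₂) * Y  ≡⟨ factor (+ suc m - + p) C₂ X (+ suc p) Y ⟩
      C₂ * ((+ suc m - + p) * X + + suc p * Y)         ≡⟨ cong (C₂ *_) closed ⟩
      C₂ * (M₁ * Z)                                    ≡⟨ ℤₚ.*-comm C₂ (M₁ * Z) ⟩
      M₁ * Z * C₂                                      ≡⟨ ℤₚ.*-assoc M₁ Z C₂ ⟩
      M₁ * (Z * C₂)                                    ≡⟨ cong (M₁ *_) (ℤₚ.*-comm Z C₂) ⟩
      M₁ * (C₂ * Z)                                    ∎)
    where
    M₁ M₂ c₁ c₀ C₂ : ℤ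
    M₁ = + suc m
    M₂ = + suc (suc m)
    c₁ = + (suc m C suc p)
    c₀ = + (suc m C p)
    C₂ = + (suc (suc m) C suc p)
    absorbX : M₂ * c₁ ≡ (+ suc m - + p) * C₂
    absorbX = [n+1]*nC[k+1]≡[n-k]*[n+1]C[k+1] (suc m) p
    absorbY : M₂ * c₀ ≡ + suc p * C₂
    absorbY = sym ([k+1]*[n+1]C[k+1]≡[n+1]*nCk-ℤ (suc m) p)
    expand : ∀ n N a b → n * (N * (a + b)) ≡ N * (n * a) + N * (n * b)
    expand = solve-∀
    reassociate : ∀ N c x d y → N * (c * x) + N * (d * y) ≡ (N * c) * x + (N * d) * y
    reassociate = solve-∀
    factor : ∀ α c x β y → (α * c) * x + (β * c) * y ≡ c * (α * x + β * y)
    factor = solve-∀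

  upFormula   : ∀ h m r p → + suc m * + afterUp h m (suc r) p ≡ + (suc m C p) * closedForm h m (suc r) p
  downFormula : ∀ h m r p → + suc m * + afterDown h m (suc r) p ≡ + (suc m C p) * closedForm h m r p

  upFormula h m r zero = begin
      + suc m * + afterUp h m (suc r) 0
    ≡⟨ cong (λ c → + suc m * + c) (walks-noPeak h (suc (lengthFrom h m)) (suc r)) ⟩
      + suc m * 0ℤ
    ≡⟨ ℤₚ.*-zeroʳ (+ suc m) ⟩
      0ℤ
    ≡⟨ cong (1ℤ *_) (closedForm-noPeak h m r) ⟨
      1ℤ * closedForm h m (suc r) 0
    ∎
  upFormula h zero r (suc p) = trans (cong (λ c → 1ℤ * + c) (afterUp-zero h (suc r) p)) (allDown r p)
    where
    -- What follows an up-step from height h with no up-steps left is D^(h+1): one return, one peak.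
    allDown : ∀ r p →
      1ℤ * + walksAfterDown 0 0 (suc r) p ≡ + (1 C suc p) * closedForm h 0 (suc r) (suc p)
    allDown zero    zero    = sym (cong (1ℤ *_)
      (cong₂ (λ x y → 1ℤ * x + y) (binom-zero (+ h + + 0 - + 1)) (ℤₚ.*-zeroʳ (+ h))))
    allDown (suc r) zero    = sym (cong (1ℤ *_)
      (cong₂ _+_ (ℤₚ.*-zeroʳ (+ suc (suc r))) (ℤₚ.*-zeroʳ (+ h))))
    allDown zero    (suc p) = refl
    allDown (suc r) (suc p) = refl
  upFormula h (suc m) r (suc p) = begin
      + suc (suc m) * + afterUp h (suc m) (suc r) (suc p)
    ≡⟨ cong (λ c → + suc (suc m) * + c) (afterUp-suc h m (suc r) p) ⟩
      + suc (suc m) * + (afterUp (suc h) m (suc r) (suc p) ℕ.+ afterDown h m (suc r) p)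
    ≡⟨ upStep m p _ _ (upFormula (suc h) m r (suc p)) (downFormula h m r p) (closedForm-up h m r p) ⟩
      + (suc (suc m) C suc p) * closedForm h (suc m) (suc r) (suc p)
    ∎

  downFormula zero m zero p = begin
      + suc m * + afterDown 0 m 1 p
    ≡⟨ cong (λ c → + suc m * + c) (afterDown-zero m 0 p) ⟩
      + suc m * + afterUp 0 m 0 p
    ≡⟨ cong (λ c → + suc m * + c) (walks-noReturn true 0 (suc (lengthFrom 0 m)) p) ⟩
      + suc m * 0ℤ
    ≡⟨ ℤₚ.*-zeroʳ (+ suc m) ⟩
      0ℤ
    ≡⟨ ℤₚ.*-zeroʳ (+ (suc m C p)) ⟨
      + (suc m C p) * 0ℤ
    ∎
  downFormula zero m (suc r) p =
    trans (cong (λ c → + suc m * + c) (afterDown-zero m (suc r) p)) (upFormula zero m r p)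
  downFormula (suc h) m r p = begin
      + suc m * + afterDown (suc h) m (suc r) p
    ≡⟨ cong (λ c → + suc m * + c) (afterDown-suc h m (suc r) p) ⟩
      + suc m * (+ afterUp (suc h) m (suc r) p + + afterDown h m (suc r) p)
    ≡⟨ ℤₚ.*-distribˡ-+ (+ suc m) (+ afterUp (suc h) m (suc r) p) (+ afterDown h m (suc r) p) ⟩
      + suc m * + afterUp (suc h) m (suc r) p + + suc m * + afterDown h m (suc r) p
    ≡⟨ cong₂ _+_ (upFormula (suc h) m r p) (downFormula h m r p) ⟩
      c * closedForm (suc h) m (suc r) p + c * closedForm h m r p
    ≡⟨ ℤₚ.*-distribˡ-+ c (closedForm (suc h) m (suc r) p) (closedForm h m r p) ⟨
      c * (closedForm (suc h) m (suc r) p + closedForm h m r p)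
    ≡⟨ cong (c *_) (closedForm-down h m r p) ⟩
      c * closedForm (suc h) m r p
    ∎
    where
    c : ℤ
    c = + (suc m C p)

  numDyck≡afterDown : ∀ m i j → numDyck (suc m) i j ≡ afterDown 0 m (suc i) j
  numDyck≡afterDown m i j = trans (countᵇ-isWalkᵇ false 0 (suc m ℕ.+ suc m) i j)
    (cong (λ L → walks false 0 (suc L) i j) (ℕₚ.+-suc m m))

  closedForm-ground : ∀ m i j → i ℕ.≤ j → j ℕ.≤ suc m →
    closedForm 0 m i j ≡ + i * + ((m ℕ.∸ i) C (j ℕ.∸ i))
  closedForm-ground m i j i≤j j≤1+m = begin
      closedForm 0 m i j
    ≡⟨ ℤₚ.+-identityʳ _ ⟩
      + i * binom (+ m - + i) (+ j - + i)
    ≡⟨ cong (λ k → + i * binom (+ m - + i) k) (trans (ℤₚ.m-n≡m⊖n j i) (ℤₚ.⊖-≥ i≤j)) ⟩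
      + i * binom (+ m - + i) (+ (j ℕ.∸ i))
    ≡⟨ cong (+ i *_) (upperIndex (i ℕₚ.≤? m)) ⟩
      + i * + ((m ℕ.∸ i) C (j ℕ.∸ i))
    ∎
    where
    upperIndex : Dec (i ℕ.≤ m) → binom (+ m - + i) (+ (j ℕ.∸ i)) ≡ + ((m ℕ.∸ i) C (j ℕ.∸ i))
    upperIndex (yes i≤m) = binom-ℕ (j ℕ.∸ i) i≤m
    upperIndex (no i≰m) rewrite ℕₚ.m≤n⇒m∸n≡0 (ℕₚ.≤-trans j≤1+m (ℕₚ.≰⇒> i≰m)) =
      binom-zero (+ m - + i)

open WalkCounts using (afterDown)
open ClosedForm using (closedForm)
open Enumeration using (numDyck≡afterDown; downFormula; closedForm-ground)
open ℕ using (_≤_; _*_; _∸_)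

mainTheorem1 : (n i j : ℕ) → 1 ≤ i → i ≤ j → j ≤ n →
    n * numDyck n i j ≡ i * ((n C j) * ((n ∸ i ∸ 1) C (j ∸ i)))
mainTheorem1 zero    (suc _) (suc _) _ (s≤s _) ()
mainTheorem1 (suc m) i       j       _ i≤j     j≤n = ℤₚ.+-injective (begin
    + (suc m * numDyck (suc m) i j)
  ≡⟨ ℤₚ.pos-* (suc m) (numDyck (suc m) i j) ⟩
    + suc m ℤ.* + numDyck (suc m) i j
  ≡⟨ cong (λ c → + suc m ℤ.* + c) (numDyck≡afterDown m i j) ⟩
    + suc m ℤ.* + afterDown 0 m (suc i) j
  ≡⟨ downFormula 0 m i j ⟩
    + (suc m C j) ℤ.* closedForm 0 m i j
  ≡⟨ cong (+ (suc m C j) ℤ.*_) (closedForm-ground m i j i≤j j≤n) ⟩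
    + (suc m C j) ℤ.* (+ i ℤ.* + binomial)
  ≡⟨ swap (+ (suc m C j)) (+ i) (+ binomial) ⟩
    + i ℤ.* (+ (suc m C j) ℤ.* + binomial)
  ≡⟨ trans (ℤₚ.pos-* i ((suc m C j) * binomial)) (cong (+ i ℤ.*_) (ℤₚ.pos-* (suc m C j) binomial)) ⟨
    + (i * ((suc m C j) * binomial))
  ≡⟨ cong (λ k → + (i * ((suc m C j) * (k C (j ∸ i))))) m∸i≡1+m∸i∸1 ⟩
    + (i * ((suc m C j) * ((suc m ∸ i ∸ 1) C (j ∸ i))))
  ∎)
  where
  open ≡-Reasoning
  binomial : ℕ
  binomial = (m ∸ i) C (j ∸ i)
  m∸i≡1+m∸i∸1 : m ∸ i ≡ suc m ∸ i ∸ 1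
  m∸i≡1+m∸i∸1 = sym (trans (ℕₚ.∸-+-assoc (suc m) i 1) (cong (suc m ∸_) (ℕₚ.+-comm i 1)))
  swap : ∀ c i x → c ℤ.* (i ℤ.* x) ≡ i ℤ.* (c ℤ.* x)
  swap = solve-∀
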